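{- For every nonnegative integer $n$, the number of even-zeroed paths of length $4n$ equals $4^n B_n$.
   Context: A path of length $l$ is a sequence of $l$ steps, each an up-step $(1,1)$ or a down-step $(1,-1)$, drawn in the plane starting at the origin (no balance condition is imposed, the endpoint is arbitrary). The $x$-intercepts of a path are the $x$-coordinates $k\in\{0,1,\dots,l\}$ of the lattice points $(k,0)$ visited by the path (this includes $k=0$). A path is called even-zeroed if all of its $x$-intercepts are divisible by $4$. $B_m=\binom{2m}{m}$ denotes the $m$th central binomial coefficient. -}

module Defs where

open import Data.Nat using (ℕ; zero; suc; _*_; _^_)
open import Data.Nat.Divisibility using (_∣_; _∣?_)
open import Data.Nat.Combinatorics using (_C_)
open import Data.Integer as ℤ using (ℤ; +_)
open import Data.Fin as Fin using (Fin; toℕ)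
open import Data.Fin.Properties using (all?)
open import Data.Vec using (Vec; []; _∷_; take)
open import Data.List using (List; []; _∷_; map; _++_; length; filter)
open import Relation.Nullary using (Dec; yes; no)
open import Relation.Nullary.Decidable using (_→-dec_)
open import Relation.Binary.PropositionalEquality using (_≡_)

data Step : Set where
  up down : Step

-- A path of length l: a sequence of l steps (arbitrary endpoint).
Path : ℕ → Set
Path l = Vec Step l

stepVal : Step → ℤ
stepVal up   = + 1
stepVal down = ℤ.- (+ 1)

height : ∀ {l} → Path l → Fin (suc l) → ℤ
height []       _            = + 0
height (s ∷ p)  Fin.zero     = + 0
height (s ∷ p)  (Fin.suc k)  = stepVal s ℤ.+ height p k

IsXIntercept : ∀ {l} → Path l → Fin (suc l) → Set
IsXIntercept p k = height p k ≡ + 0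

EvenZeroed : ∀ {l} → Path l → Set
EvenZeroed {l} p = ∀ (k : Fin (suc l)) → IsXIntercept p k → 4 ∣ toℕ k

evenZeroed? : ∀ {l} (p : Path l) → Dec (EvenZeroed p)
evenZeroed? p = all? (λ k → (height p k ℤ.≟ + 0) →-dec (4 ∣? toℕ k))

allPaths : (l : ℕ) → List (Path l)
allPaths zero    = [] ∷ []
allPaths (suc l) = map (up ∷_) (allPaths l) ++ map (down ∷_) (allPaths l)

numEvenZeroed : ℕ → ℕ
numEvenZeroed l = length (filter evenZeroed? (allPaths l))

B : ℕ → ℕ
B m = (2 * m) C m

-- Identify a power series with its coefficient sequence ℕ → ℤ, multiplied by Cauchy product.
-- Let Z(x) = Σ B_m x^m, which counts the paths of length 2m ending on the axis, and E(x) the series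
-- of excursions (paths of length 2m returning to the axis for the first time at the end).  Cutting
-- such a path, resp. an arbitrary path, at its first return gives Z = 1 + E Z, resp.
-- 1/(1 - 4x) = N + E/(1 - 4x), where N counts the paths of length 2m never returning to the axis.
-- From (m + 1) B_(m+1) = (4m + 2) B_m one gets Z² = 1/(1 - 4x), and therefore N = Z.
-- An even-zeroed path of length 4k is either non-returning or an excursion of length divisible
-- by 4 followed by an even-zeroed path, so its series X satisfies (1 - E_ev) X = N_ev, where the
-- subscript keeps the coefficients of even index.  On the other hand Z(x) Z(-x) = T(x²) for
-- T(y) = Σ 4^k B_k y^k, since both sides square to 1/((1 - 4x)(1 + 4x)); multiplying by
-- 1 - E(x) = 1/Z(x) and keeping even coefficients gives (1 - E_ev) T = Z_ev = N_ev, so X = T.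

module Submission where

open import Defs
open import Data.Bool using (true; false)
open import Data.Fin as Fin using (toℕ)
open import Data.Fin.Properties using (all?)
open import Data.Integer using (ℤ; +_; -[1+_]; -1ℤ; ∣_∣; _+_; _*_; -_; _-_; _^_; ≢-nonZero)
  renaming (_≟_ to _≟ℤ_)
import Data.Integer.Properties as ℤP
open import Data.Integer.Tactic.RingSolver using (solve-∀)
open import Data.List using ([]; _∷_; map; _++_; length; filter)
open import Data.List.Properties using (length-++; filter-++; filter-≐; filter-none; filter-accept)
import Data.List.Relation.Unary.All as All
open import Data.Nat as ℕ using (ℕ; zero; suc; _∸_; _≤_; _<_; z≤n; s≤s)
open import Data.Nat.Combinatorics using (_C_; nCk+nC[k+1]≡[n+1]C[k+1]; nCk≡nC[n∸k]; k>n⇒nCk≡0; nC1≡n)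
open import Data.Nat.Divisibility using (_∣_; _∣?_; divides-refl; _∣0; ∣-refl; ∣m∣n⇒∣m+n)
open import Data.Nat.Induction using (<-rec)
import Data.Nat.Properties as ℕP
import Data.Nat.Tactic.RingSolver as ℕS
open import Data.Product using (_,_)
open import Data.Vec using ([]; _∷_)
open import Function using (_∘_)
open import Level using (0ℓ)
open import Relation.Binary.PropositionalEquality
import Relation.Binary.Reasoning.Setoid
open import Relation.Nullary using (Dec; yes; no; ¬_; contradiction)
open import Relation.Nullary.Decidable using (_→-dec_; does)
open import Relation.Unary using (Pred; Decidable; _≐_)
open import Algebra.Properties.AbelianGroup ℤP.+-0-abelianGroup using () renaming (∙-cancelʳ to +-cancelʳ)

-- Finite sums

Seq : Set
Seq = ℕ → ℤ

∑≤ : ℕ → Seq → ℤ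
∑≤ zero    f = f 0
∑≤ (suc n) f = f 0 + ∑≤ n (f ∘ suc)

-- The body of ∑[ j ≤ n ] extends over _*_ but not over _+_.
infix 6.5 ∑≤
syntax ∑≤ n (λ j → e) = ∑[ j ≤ n ] e

∑-cong : ∀ n {f g : Seq} → (∀ j → j ≤ n → f j ≡ g j) → ∑≤ n f ≡ ∑≤ n g
∑-cong zero    eq = eq 0 z≤n
∑-cong (suc n) eq = cong₂ _+_ (eq 0 z≤n) (∑-cong n (λ j j≤n → eq (suc j) (s≤s j≤n)))

∑-zero : ∀ n {f : Seq} → (∀ j → j ≤ n → f j ≡ + 0) → ∑≤ n f ≡ + 0
∑-zero zero    eq = eq 0 z≤n
∑-zero (suc n) eq = cong₂ _+_ (eq 0 z≤n) (∑-zero n (λ j j≤n → eq (suc j) (s≤s j≤n)))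

∑-distrib-+ : ∀ n (f g : Seq) → ∑[ j ≤ n ] (f j + g j) ≡ ∑≤ n f + ∑≤ n g
∑-distrib-+ zero    f g = refl
∑-distrib-+ (suc n) f g =
  trans (cong (λ x → f 0 + g 0 + x) (∑-distrib-+ n (f ∘ suc) (g ∘ suc))) (interchange (f 0) (g 0) _ _)
  where
  interchange : ∀ a b c d → a + b + (c + d) ≡ a + c + (b + d)
  interchange = solve-∀

*-distribˡ-∑ : ∀ n c (f : Seq) → ∑[ j ≤ n ] (c * f j) ≡ c * ∑≤ n f
*-distribˡ-∑ zero    c f = refl
*-distribˡ-∑ (suc n) c f =
  trans (cong (λ x → c * f 0 + x) (*-distribˡ-∑ n c (f ∘ suc))) (sym (ℤP.*-distribˡ-+ c (f 0) _))

*-distribʳ-∑ : ∀ n c (f : Seq) → ∑[ j ≤ n ] (f j * c) ≡ ∑≤ n f * c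
*-distribʳ-∑ n c f = begin
  ∑[ j ≤ n ] (f j * c)    ≡⟨ ∑-cong n (λ j _ → ℤP.*-comm (f j) c) ⟩
  ∑[ j ≤ n ] (c * f j)    ≡⟨ *-distribˡ-∑ n c f ⟩
  c * ∑≤ n f              ≡⟨ ℤP.*-comm c _ ⟩
  ∑≤ n f * c              ∎
  where open ≡-Reasoning

neg-distrib-∑ : ∀ n (f : Seq) → ∑[ j ≤ n ] (- f j) ≡ - ∑≤ n f
neg-distrib-∑ zero    f = refl
neg-distrib-∑ (suc n) f =
  trans (cong (λ x → - f 0 + x) (neg-distrib-∑ n (f ∘ suc))) (sym (ℤP.neg-distrib-+ (f 0) _))

∑-suc : ∀ n (f : Seq) → ∑≤ (suc n) f ≡ ∑≤ n f + f (suc n)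
∑-suc zero    f = refl
∑-suc (suc n) f = trans (cong (λ x → f 0 + x) (∑-suc n (f ∘ suc))) (sym (ℤP.+-assoc (f 0) _ _))

∑-split : ∀ m p (f : Seq) → ∑≤ (m ℕ.+ suc p) f ≡ ∑≤ m f + ∑[ r ≤ p ] f (suc (m ℕ.+ r))
∑-split zero    p f = refl
∑-split (suc m) p f =
  trans (cong (λ x → f 0 + x) (∑-split m p (f ∘ suc))) (sym (ℤP.+-assoc (f 0) _ _))

∑-reverse : ∀ n (f : Seq) → ∑≤ n f ≡ ∑[ j ≤ n ] f (n ∸ j)
∑-reverse zero    f = refl
∑-reverse (suc n) f = begin
  ∑≤ (suc n) f                        ≡⟨ ∑-suc n f ⟩
  ∑≤ n f + f (suc n)                  ≡⟨ cong (_+ f (suc n)) (∑-reverse n f) ⟩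
  ∑[ j ≤ n ] f (n ∸ j) + f (suc n)    ≡⟨ ℤP.+-comm _ (f (suc n)) ⟩
  f (suc n) + ∑[ j ≤ n ] f (n ∸ j)    ∎
  where open ≡-Reasoning

∑-triangle : ∀ n (F : ℕ → ℕ → ℤ) →
             ∑[ i ≤ n ] ∑[ j ≤ i ] F i j ≡ ∑[ j ≤ n ] ∑[ k ≤ n ∸ j ] F (j ℕ.+ k) j
∑-triangle zero    F = refl
∑-triangle (suc n) F = begin
  ∑[ i ≤ suc n ] ∑[ j ≤ i ] F i j
    ≡⟨ ∑-suc n _ ⟩
  ∑[ i ≤ n ] ∑[ j ≤ i ] F i j + ∑[ j ≤ suc n ] F (suc n) j
    ≡⟨ cong₂ _+_ (∑-triangle n F) (∑-suc n _) ⟩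
  ∑[ j ≤ n ] col n j + (∑[ j ≤ n ] F (suc n) j + F (suc n) (suc n))
    ≡⟨ ℤP.+-assoc (∑[ j ≤ n ] col n j) _ _ ⟨
  ∑[ j ≤ n ] col n j + ∑[ j ≤ n ] F (suc n) j + F (suc n) (suc n)
    ≡⟨ cong (_+ F (suc n) (suc n)) (∑-distrib-+ n (col n) _) ⟨
  ∑[ j ≤ n ] (col n j + F (suc n) j) + F (suc n) (suc n)
    ≡⟨ cong₂ _+_ (∑-cong n extend-col) (cong (λ m → F m (suc n)) (ℕP.+-identityʳ (suc n))) ⟨
  ∑[ j ≤ n ] col (suc n) j + F (suc n ℕ.+ 0) (suc n)
    ≡⟨ cong (λ m → ∑[ j ≤ n ] col (suc n) j + ∑[ k ≤ m ] F (suc n ℕ.+ k) (suc n)) (ℕP.n∸n≡0 n) ⟨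
  ∑[ j ≤ n ] col (suc n) j + col (suc n) (suc n)
    ≡⟨ ∑-suc n (col (suc n)) ⟨
  ∑[ j ≤ suc n ] col (suc n) j
    ∎
  where
  open ≡-Reasoning
  col : ℕ → ℕ → ℤ
  col m j = ∑[ k ≤ m ∸ j ] F (j ℕ.+ k) j
  extend-col : ∀ j → j ≤ n → col (suc n) j ≡ col n j + F (suc n) j
  extend-col j j≤n = begin
    ∑[ k ≤ suc n ∸ j ] F (j ℕ.+ k) j
      ≡⟨ cong (λ m → ∑[ k ≤ m ] F (j ℕ.+ k) j) (ℕP.+-∸-assoc 1 j≤n) ⟩
    ∑[ k ≤ suc (n ∸ j) ] F (j ℕ.+ k) j
      ≡⟨ ∑-suc (n ∸ j) _ ⟩
    col n j + F (j ℕ.+ suc (n ∸ j)) j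
      ≡⟨ cong (λ m → col n j + F m j) (trans (ℕP.+-suc j (n ∸ j)) (cong suc (ℕP.m+[n∸m]≡n j≤n))) ⟩
    col n j + F (suc n) j
      ∎

∑-multiples : ∀ q k (F : Seq) → (∀ i r → r < q → F (suc (i ℕ.* suc q ℕ.+ r)) ≡ + 0) →
              ∑≤ (k ℕ.* suc q) F ≡ ∑[ i ≤ k ] F (i ℕ.* suc q)
∑-multiples q zero    F off = refl
∑-multiples q (suc k) F off = begin
  ∑≤ (suc k ℕ.* suc q) F
    ≡⟨ cong (λ m → ∑≤ m F) (ℕP.+-comm (suc q) (k ℕ.* suc q)) ⟩
  ∑≤ (k ℕ.* suc q ℕ.+ suc q) F
    ≡⟨ ∑-split (k ℕ.* suc q) q F ⟩
  ∑≤ (k ℕ.* suc q) F + ∑[ r ≤ q ] F (suc (k ℕ.* suc q ℕ.+ r))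
    ≡⟨ cong₂ _+_ (∑-multiples q k F off)
                   (trans (block q ℕP.≤-refl) (cong (F ∘ suc) (ℕP.+-comm (k ℕ.* suc q) q))) ⟩
  ∑[ i ≤ k ] F (i ℕ.* suc q) + F (suc k ℕ.* suc q)
    ≡⟨ ∑-suc k _ ⟨
  ∑[ i ≤ suc k ] F (i ℕ.* suc q)
    ∎
  where
  open ≡-Reasoning
  block : ∀ p → p ≤ q → ∑[ r ≤ p ] F (suc (k ℕ.* suc q ℕ.+ r)) ≡ F (suc (k ℕ.* suc q ℕ.+ p))
  block zero    _   = refl
  block (suc p) p≤q = begin
    ∑[ r ≤ suc p ] F (suc (k ℕ.* suc q ℕ.+ r))
      ≡⟨ ∑-suc p _ ⟩
    ∑[ r ≤ p ] F (suc (k ℕ.* suc q ℕ.+ r)) + F (suc (k ℕ.* suc q ℕ.+ suc p))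
      ≡⟨ cong (_+ F (suc (k ℕ.* suc q ℕ.+ suc p))) (trans (block p (ℕP.<⇒≤ p≤q)) (off k p p≤q)) ⟩
    + 0 + F (suc (k ℕ.* suc q ℕ.+ suc p))
      ≡⟨ ℤP.+-identityˡ _ ⟩
    F (suc (k ℕ.* suc q ℕ.+ suc p))
      ∎

-- Cauchy products

infixl 7 _⋆_
infixl 6 _⊕_ _⊖_

_⋆_ : Seq → Seq → Seq
(f ⋆ g) n = ∑[ j ≤ n ] f j * g (n ∸ j)

_⊕_ : Seq → Seq → Seq
(f ⊕ g) n = f n + g n

_⊖_ : Seq → Seq → Seq
(f ⊖ g) n = f n - g n

δ : Seq
δ zero    = + 1
δ (suc n) = + 0

module ≗-Reasoning = Relation.Binary.Reasoning.Setoid (ℕ →-setoid ℤ)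

⋆-cong : ∀ {f f′ g g′} → f ≗ f′ → g ≗ g′ → f ⋆ g ≗ f′ ⋆ g′
⋆-cong f≗f′ g≗g′ n = ∑-cong n (λ j _ → cong₂ _*_ (f≗f′ j) (g≗g′ (n ∸ j)))

⋆-congˡ : ∀ f {g g′} → g ≗ g′ → f ⋆ g ≗ f ⋆ g′
⋆-congˡ f {g} {g′} = ⋆-cong {f} {f} {g} {g′} (λ _ → refl)

⋆-congʳ : ∀ {f f′} g → f ≗ f′ → f ⋆ g ≗ f′ ⋆ g
⋆-congʳ {f} {f′} g f≗f′ = ⋆-cong {f} {f′} {g} {g} f≗f′ (λ _ → refl)

⋆-comm : ∀ f g → f ⋆ g ≗ g ⋆ f
⋆-comm f g n = trans (∑-reverse n _) (∑-cong n (λ j j≤n →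
  trans (cong (λ i → f (n ∸ j) * g i) (ℕP.m∸[m∸n]≡n j≤n)) (ℤP.*-comm (f (n ∸ j)) (g j))))

⋆-assoc : ∀ f g h → (f ⋆ g) ⋆ h ≗ f ⋆ (g ⋆ h)
⋆-assoc f g h n = begin
  ∑[ i ≤ n ] (∑[ j ≤ i ] f j * g (i ∸ j)) * h (n ∸ i)
    ≡⟨ ∑-cong n (λ i _ → *-distribʳ-∑ i (h (n ∸ i)) _) ⟨
  ∑[ i ≤ n ] ∑[ j ≤ i ] f j * g (i ∸ j) * h (n ∸ i)
    ≡⟨ ∑-triangle n (λ i j → f j * g (i ∸ j) * h (n ∸ i)) ⟩
  ∑[ j ≤ n ] ∑[ k ≤ n ∸ j ] f j * g (j ℕ.+ k ∸ j) * h (n ∸ (j ℕ.+ k))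
    ≡⟨ ∑-cong n (λ j _ → ∑-cong (n ∸ j) (λ k _ → reindex j k)) ⟩
  ∑[ j ≤ n ] ∑[ k ≤ n ∸ j ] f j * (g k * h (n ∸ j ∸ k))
    ≡⟨ ∑-cong n (λ j _ → *-distribˡ-∑ (n ∸ j) (f j) _) ⟩
  ∑[ j ≤ n ] f j * (∑[ k ≤ n ∸ j ] g k * h (n ∸ j ∸ k))
    ∎
  where
  open ≡-Reasoning
  reindex : ∀ j k → f j * g (j ℕ.+ k ∸ j) * h (n ∸ (j ℕ.+ k)) ≡ f j * (g k * h (n ∸ j ∸ k))
  reindex j k = trans (cong₂ (λ a b → f j * g a * h b) (ℕP.m+n∸m≡n j k) (sym (ℕP.∸-+-assoc n j k)))
                      (ℤP.*-assoc (f j) _ _)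

⋆-interchange : ∀ a b c d → (a ⋆ b) ⋆ (c ⋆ d) ≗ (a ⋆ c) ⋆ (b ⋆ d)
⋆-interchange a b c d = begin
  (a ⋆ b) ⋆ (c ⋆ d)     ≈⟨ ⋆-assoc a b (c ⋆ d) ⟩
  a ⋆ (b ⋆ (c ⋆ d))     ≈⟨ ⋆-congˡ a (⋆-assoc b c d) ⟨
  a ⋆ ((b ⋆ c) ⋆ d)     ≈⟨ ⋆-congˡ a (⋆-congʳ d (⋆-comm b c)) ⟩
  a ⋆ ((c ⋆ b) ⋆ d)     ≈⟨ ⋆-congˡ a (⋆-assoc c b d) ⟩
  a ⋆ (c ⋆ (b ⋆ d))     ≈⟨ ⋆-assoc a c (b ⋆ d) ⟨
  (a ⋆ c) ⋆ (b ⋆ d)     ∎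
  where open ≗-Reasoning

⋆-distribʳ-⊕ : ∀ f g h → (f ⊕ g) ⋆ h ≗ f ⋆ h ⊕ g ⋆ h
⋆-distribʳ-⊕ f g h n =
  trans (∑-cong n (λ j _ → ℤP.*-distribʳ-+ (h (n ∸ j)) (f j) (g j))) (∑-distrib-+ n _ _)

⋆-distribʳ-⊖ : ∀ f g h → (f ⊖ g) ⋆ h ≗ f ⋆ h ⊖ g ⋆ h
⋆-distribʳ-⊖ f g h n = begin
  ∑[ j ≤ n ] (f j - g j) * h (n ∸ j)
    ≡⟨ ∑-cong n (λ j _ → distrib (f j) (g j) (h (n ∸ j))) ⟩
  ∑[ j ≤ n ] (f j * h (n ∸ j) + - (g j * h (n ∸ j)))
    ≡⟨ ∑-distrib-+ n _ _ ⟩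
  (f ⋆ h) n + ∑[ j ≤ n ] - (g j * h (n ∸ j))
    ≡⟨ cong (λ x → (f ⋆ h) n + x) (neg-distrib-∑ n _) ⟩
  (f ⋆ h) n - (g ⋆ h) n
    ∎
  where
  open ≡-Reasoning
  distrib : ∀ a b c → (a - b) * c ≡ a * c + - (b * c)
  distrib = solve-∀

⋆-identityˡ : ∀ f → δ ⋆ f ≗ f
⋆-identityˡ f zero    = ℤP.*-identityˡ (f 0)
⋆-identityˡ f (suc n) = begin
  + 1 * f (suc n) + ∑[ j ≤ n ] + 0 * f (n ∸ j)
    ≡⟨ cong₂ _+_ (ℤP.*-identityˡ (f (suc n))) (∑-zero n (λ j _ → ℤP.*-zeroˡ (f (n ∸ j)))) ⟩
  f (suc n) + + 0
    ≡⟨ ℤP.+-identityʳ _ ⟩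
  f (suc n)
    ∎
  where open ≡-Reasoning

⋆-identityʳ : ∀ f → f ⋆ δ ≗ f
⋆-identityʳ f n = trans (⋆-comm f δ n) (⋆-identityˡ f n)

⋆-cancelˡ : ∀ W {X Y} → W 0 ≢ + 0 → W ⋆ X ≗ W ⋆ Y → X ≗ Y
⋆-cancelˡ W {X} {Y} W₀≢0 eq = <-rec (λ n → X n ≡ Y n) agree
  where
  cancel-W₀ : ∀ {x y} → W 0 * x ≡ W 0 * y → x ≡ y
  cancel-W₀ = ℤP.*-cancelˡ-≡ (W 0) _ _ {{≢-nonZero W₀≢0}}
  agree : ∀ n → (∀ {m} → m < n → X m ≡ Y m) → X n ≡ Y n
  agree zero    _  = cancel-W₀ (eq 0)
  agree (suc n) ih = cancel-W₀ (+-cancelʳ _ _ _ (begin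
    W 0 * X (suc n) + ∑[ j ≤ n ] W (suc j) * X (n ∸ j)   ≡⟨ eq (suc n) ⟩
    W 0 * Y (suc n) + ∑[ j ≤ n ] W (suc j) * Y (n ∸ j)   ≡⟨ cong (λ s → W 0 * Y (suc n) + s) (∑-cong n earlier) ⟨
    W 0 * Y (suc n) + ∑[ j ≤ n ] W (suc j) * X (n ∸ j)   ∎))
    where
    open ≡-Reasoning
    earlier : ∀ j → j ≤ n → W (suc j) * X (n ∸ j) ≡ W (suc j) * Y (n ∸ j)
    earlier j _ = cong (W (suc j) *_) (ih (s≤s (ℕP.m∸n≤m n j)))

⋆-square-unique : ∀ U V → U 0 + V 0 ≢ + 0 → U ⋆ U ≗ V ⋆ V → U ≗ V
⋆-square-unique U V U₀+V₀≢0 squares = ⋆-cancelˡ (U ⊕ V) U₀+V₀≢0 λ n → begin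
  ((U ⊕ V) ⋆ U) n           ≡⟨ ⋆-distribʳ-⊕ U V U n ⟩
  (U ⋆ U) n + (V ⋆ U) n     ≡⟨ cong₂ _+_ (squares n) (⋆-comm V U n) ⟩
  (V ⋆ V) n + (U ⋆ V) n     ≡⟨ ℤP.+-comm ((V ⋆ V) n) _ ⟩
  (U ⋆ V) n + (V ⋆ V) n     ≡⟨ ⋆-distribʳ-⊕ U V V n ⟨
  ((U ⊕ V) ⋆ V) n           ∎
  where open ≡-Reasoning

recursion⇒⋆ : ∀ a e X → X ≗ a ⊕ e ⋆ X → (δ ⊖ e) ⋆ X ≗ a
recursion⇒⋆ a e X rec n = begin
  ((δ ⊖ e) ⋆ X) n                 ≡⟨ ⋆-distribʳ-⊖ δ e X n ⟩
  (δ ⋆ X) n - (e ⋆ X) n           ≡⟨ cong (_- (e ⋆ X) n) (trans (⋆-identityˡ X n) (rec n)) ⟩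
  a n + (e ⋆ X) n - (e ⋆ X) n     ≡⟨ add-sub (a n) ((e ⋆ X) n) ⟩
  a n                             ∎
  where
  open ≡-Reasoning
  add-sub : ∀ x y → x + y - y ≡ x
  add-sub = solve-∀

-- Stretching and scaling

data Parity : ℕ → Set where
  even : ∀ k → Parity (k ℕ.* 2)
  odd  : ∀ k → Parity (suc (k ℕ.* 2))

parity : ∀ n → Parity n
parity zero = even 0
parity (suc n) with parity n
... | even k = odd k
... | odd k  = even (suc k)

stretch : Seq → Seq
stretch f zero          = f 0
stretch f (suc zero)    = + 0
stretch f (suc (suc n)) = stretch (f ∘ suc) n

evens : Seq → Seq
evens f k = f (k ℕ.* 2)

evens-cong : ∀ {f g} → f ≗ g → evens f ≗ evens g
evens-cong f≗g k = f≗g (k ℕ.* 2)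

stretch-even : ∀ f i → stretch f (i ℕ.* 2) ≡ f i
stretch-even f zero    = refl
stretch-even f (suc i) = stretch-even (f ∘ suc) i

stretch-odd : ∀ f i → stretch f (suc (i ℕ.* 2)) ≡ + 0
stretch-odd f zero    = refl
stretch-odd f (suc i) = stretch-odd (f ∘ suc) i

stretch-cong : ∀ {f g} → f ≗ g → stretch f ≗ stretch g
stretch-cong f≗g zero          = f≗g 0
stretch-cong f≗g (suc zero)    = refl
stretch-cong f≗g (suc (suc n)) = stretch-cong (f≗g ∘ suc) n

evens-stretch-⋆ : ∀ T f → evens (stretch T ⋆ f) ≗ T ⋆ evens f
evens-stretch-⋆ T f k = begin
  ∑[ j ≤ k ℕ.* 2 ] stretch T j * f (k ℕ.* 2 ∸ j)
    ≡⟨ ∑-multiples 1 k _ odd-terms ⟩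
  ∑[ i ≤ k ] stretch T (i ℕ.* 2) * f (k ℕ.* 2 ∸ i ℕ.* 2)
    ≡⟨ ∑-cong k (λ i _ → cong₂ _*_ (stretch-even T i) (cong f (sym (ℕP.*-distribʳ-∸ 2 k i)))) ⟩
  ∑[ i ≤ k ] T i * f ((k ∸ i) ℕ.* 2)
    ∎
  where
  open ≡-Reasoning
  odd-terms : ∀ i r → r < 1 → stretch T (suc (i ℕ.* 2 ℕ.+ r)) * f (k ℕ.* 2 ∸ suc (i ℕ.* 2 ℕ.+ r)) ≡ + 0
  odd-terms i zero _ rewrite ℕP.+-identityʳ (i ℕ.* 2) | stretch-odd T i = ℤP.*-zeroˡ (f (k ℕ.* 2 ∸ suc (i ℕ.* 2)))
  odd-terms i (suc r) (s≤s ())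

stretch-⋆ : ∀ T U → stretch T ⋆ stretch U ≗ stretch (T ⋆ U)
stretch-⋆ T U n with parity n
... | even k = begin
  (stretch T ⋆ stretch U) (k ℕ.* 2)   ≡⟨ evens-stretch-⋆ T (stretch U) k ⟩
  (T ⋆ evens (stretch U)) k           ≡⟨ ⋆-congˡ T (stretch-even U) k ⟩
  (T ⋆ U) k                           ≡⟨ stretch-even (T ⋆ U) k ⟨
  stretch (T ⋆ U) (k ℕ.* 2)           ∎
  where open ≡-Reasoning
... | odd k = trans (∑-zero (suc (k ℕ.* 2)) vanishing) (sym (stretch-odd (T ⋆ U) k))
  where
  vanishing : ∀ j → j ≤ suc (k ℕ.* 2) → stretch T j * stretch U (suc (k ℕ.* 2) ∸ j) ≡ + 0
  vanishing j j≤ with parity j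
  ... | odd i rewrite stretch-odd T i = ℤP.*-zeroˡ (stretch U (suc (k ℕ.* 2) ∸ suc (i ℕ.* 2)))
  ... | even i = trans (cong (λ m → stretch T (i ℕ.* 2) * stretch U m) odd-rest)
                       (trans (cong (stretch T (i ℕ.* 2) *_) (stretch-odd U (k ∸ i))) (ℤP.*-zeroʳ (stretch T (i ℕ.* 2))))
    where
    halve : ∀ i k → i ℕ.* 2 ≤ suc (k ℕ.* 2) → i ≤ k
    halve zero    k       _                 = z≤n
    halve (suc i) zero    (s≤s ())
    halve (suc i) (suc k) (s≤s (s≤s i≤k)) = s≤s (halve i k i≤k)
    i≤k : i ≤ k
    i≤k = halve i k j≤
    odd-rest : suc (k ℕ.* 2) ∸ i ℕ.* 2 ≡ suc ((k ∸ i) ℕ.* 2)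
    odd-rest = trans (ℕP.+-∸-assoc 1 (ℕP.*-monoˡ-≤ 2 i≤k)) (cong suc (sym (ℕP.*-distribʳ-∸ 2 k i)))

pow : ℤ → Seq
pow a n = a ^ n

pow-split : ∀ a {j n} → j ≤ n → a ^ j * a ^ (n ∸ j) ≡ a ^ n
pow-split a {j} {n} j≤n = trans (sym (ℤP.^-distribˡ-+-* a j (n ∸ j))) (cong (a ^_) (ℕP.m+[n∸m]≡n j≤n))

scale : ℤ → Seq → Seq
scale a f n = a ^ n * f n

scale-cong : ∀ a {f g} → f ≗ g → scale a f ≗ scale a g
scale-cong a f≗g n = cong (a ^ n *_) (f≗g n)

scale-⋆ : ∀ a f g → scale a f ⋆ scale a g ≗ scale a (f ⋆ g)
scale-⋆ a f g n = trans (∑-cong n regroup) (*-distribˡ-∑ n (a ^ n) _)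
  where
  swap-middle : ∀ w x y z → w * x * (y * z) ≡ w * y * (x * z)
  swap-middle = solve-∀
  regroup : ∀ j → j ≤ n → a ^ j * f j * (a ^ (n ∸ j) * g (n ∸ j)) ≡ a ^ n * (f j * g (n ∸ j))
  regroup j j≤n = trans (swap-middle (a ^ j) (f j) (a ^ (n ∸ j)) (g (n ∸ j)))
    (cong (_* (f j * g (n ∸ j))) (pow-split a j≤n))

scale-pow : ∀ a → scale a (pow a) ≗ evens (pow a)
scale-pow a k = trans (sym (ℤP.^-distribˡ-+-* a k k)) (cong (a ^_) (trans (cong (k ℕ.+_) (sym (ℕP.+-identityʳ k))) (ℕP.*-comm 2 k)))

twist : Seq → Seq
twist = scale -1ℤ

evens-twist : ∀ f → evens (twist f) ≗ evens f
evens-twist f k = trans (cong (_* f (k ℕ.* 2)) sign-even) (ℤP.*-identityˡ _)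
  where
  sign-even : -1ℤ ^ (k ℕ.* 2) ≡ + 1
  sign-even = trans (cong (-1ℤ ^_) (ℕP.*-comm k 2)) (trans (sym (ℤP.^-*-assoc -1ℤ 2 k)) (ℤP.^-zeroˡ k))

alternating : Seq
alternating n = ∑[ j ≤ n ] -1ℤ ^ j

alternating-suc : ∀ n → alternating (suc n) ≡ + 1 - alternating n
alternating-suc n = cong (λ x → + 1 + x) (trans (*-distribˡ-∑ n -1ℤ (-1ℤ ^_)) (ℤP.-1*i≡-i (alternating n)))

alternating-even : ∀ k → alternating (k ℕ.* 2) ≡ + 1
alternating-odd  : ∀ k → alternating (suc (k ℕ.* 2)) ≡ + 0
alternating-even zero    = refl
alternating-even (suc k) = trans (alternating-suc (suc (k ℕ.* 2))) (cong (λ x → + 1 - x) (alternating-odd k))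
alternating-odd k = trans (alternating-suc (k ℕ.* 2)) (cong (λ x → + 1 - x) (alternating-even k))

pow-⋆-twist-pow : ∀ a → pow a ⋆ twist (pow a) ≗ stretch (evens (pow a))
pow-⋆-twist-pow a n = trans factor-out (by-parity (parity n))
  where
  open ≡-Reasoning
  regroup : ∀ x s y → x * (s * y) ≡ x * y * s
  regroup = solve-∀
  factor-out : (pow a ⋆ twist (pow a)) n ≡ a ^ n * alternating n
  factor-out = begin
    ∑[ j ≤ n ] a ^ j * (-1ℤ ^ (n ∸ j) * a ^ (n ∸ j))
      ≡⟨ ∑-cong n (λ j j≤n → trans (regroup (a ^ j) (-1ℤ ^ (n ∸ j)) (a ^ (n ∸ j)))
           (cong (_* -1ℤ ^ (n ∸ j)) (pow-split a j≤n))) ⟩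
    ∑[ j ≤ n ] a ^ n * -1ℤ ^ (n ∸ j)
      ≡⟨ *-distribˡ-∑ n (a ^ n) _ ⟩
    a ^ n * (∑[ j ≤ n ] -1ℤ ^ (n ∸ j))
      ≡⟨ cong (a ^ n *_) (∑-reverse n (-1ℤ ^_)) ⟨
    a ^ n * alternating n
      ∎
  by-parity : ∀ {n} → Parity n → a ^ n * alternating n ≡ stretch (evens (pow a)) n
  by-parity (even k) = trans (cong (a ^ (k ℕ.* 2) *_) (alternating-even k))
                             (trans (ℤP.*-identityʳ (a ^ (k ℕ.* 2))) (sym (stretch-even (evens (pow a)) k)))
  by-parity (odd k)  = trans (cong (a ^ suc (k ℕ.* 2) *_) (alternating-odd k))
                             (trans (ℤP.*-zeroʳ (a ^ suc (k ℕ.* 2))) (sym (stretch-odd (evens (pow a)) k)))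

-- Central binomial coefficients

absorption : ∀ n k → suc k ℕ.* (suc n C suc k) ≡ suc n ℕ.* (n C k)
absorption zero    zero    = refl
absorption zero    (suc k) rewrite k>n⇒nCk≡0 {1} {suc (suc k)} (s≤s (s≤s z≤n)) | k>n⇒nCk≡0 {0} {suc k} (s≤s z≤n)
  = ℕP.*-zeroʳ (suc (suc k))
absorption (suc n) zero    = trans (ℕP.*-identityˡ _) (trans (nC1≡n (suc (suc n))) (sym (ℕP.*-identityʳ (suc (suc n)))))
absorption (suc n) (suc k) = begin
  suc K ℕ.* (suc N C suc K)                          ≡⟨ cong (suc K ℕ.*_) (nCk+nC[k+1]≡[n+1]C[k+1] N K) ⟨
  suc K ℕ.* (N C K ℕ.+ N C suc K)                    ≡⟨ ℕP.*-distribˡ-+ (suc K) (N C K) (N C suc K) ⟩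
  N C K ℕ.+ K ℕ.* (N C K) ℕ.+ suc K ℕ.* (N C suc K)  ≡⟨ cong₂ (λ a b → N C K ℕ.+ a ℕ.+ b) (absorption n k) (absorption n K) ⟩
  N C K ℕ.+ N ℕ.* (n C k) ℕ.+ N ℕ.* (n C K)          ≡⟨ ℕP.+-assoc (N C K) _ _ ⟩
  N C K ℕ.+ (N ℕ.* (n C k) ℕ.+ N ℕ.* (n C K))        ≡⟨ cong (N C K ℕ.+_) (ℕP.*-distribˡ-+ N (n C k) (n C K)) ⟨
  N C K ℕ.+ N ℕ.* (n C k ℕ.+ n C K)                  ≡⟨ cong (λ c → N C K ℕ.+ N ℕ.* c) (nCk+nC[k+1]≡[n+1]C[k+1] n k) ⟩
  suc N ℕ.* (N C K)                                  ∎
  where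
  open ≡-Reasoning
  N = suc n
  K = suc k

central-recurrence : ∀ k → suc k ℕ.* B (suc k) ≡ (4 ℕ.* k ℕ.+ 2) ℕ.* B k
central-recurrence k = ℕP.*-cancelˡ-≡ _ _ (suc k) (begin
  suc k ℕ.* (suc k ℕ.* B (suc k))
    ≡⟨ cong (λ m → suc k ℕ.* (suc k ℕ.* (m C suc k))) 2[1+k]≡2+2k ⟩
  suc k ℕ.* (suc k ℕ.* (suc (suc n) C suc k))
    ≡⟨ cong (suc k ℕ.*_) (absorption (suc n) k) ⟩
  suc k ℕ.* (suc (suc n) ℕ.* (suc n C k))
    ≡⟨ cong (λ c → suc k ℕ.* (suc (suc n) ℕ.* c)) symmetry ⟩
  suc k ℕ.* (suc (suc n) ℕ.* (suc n C suc k))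
    ≡⟨ regroup (suc k) (suc (suc n)) (suc n C suc k) ⟩
  suc (suc n) ℕ.* (suc k ℕ.* (suc n C suc k))
    ≡⟨ cong (suc (suc n) ℕ.*_) (absorption n k) ⟩
  suc (suc n) ℕ.* (suc n ℕ.* B k)
    ≡⟨ arithmetic k (B k) ⟩
  suc k ℕ.* ((4 ℕ.* k ℕ.+ 2) ℕ.* B k)
    ∎)
  where
  open ≡-Reasoning
  n = 2 ℕ.* k
  2[1+k]≡2+2k : 2 ℕ.* suc k ≡ suc (suc n)
  2[1+k]≡2+2k = ℕP.*-suc 2 k
  symmetry : suc n C k ≡ suc n C suc k
  symmetry = trans (nCk≡nC[n∸k] (ℕP.m≤n⇒m≤1+n (ℕP.m≤n*m k 2)))
                   (cong (suc n C_) (trans (ℕP.+-∸-assoc 1 (ℕP.m≤n*m k 2))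
                     (cong suc (trans (ℕP.m+n∸m≡n k (1 ℕ.* k)) (ℕP.*-identityˡ k)))))
  regroup : ∀ x y z → x ℕ.* (y ℕ.* z) ≡ y ℕ.* (x ℕ.* z)
  regroup = ℕS.solve-∀
  arithmetic : ∀ k c → suc (suc (2 ℕ.* k)) ℕ.* (suc (2 ℕ.* k) ℕ.* c) ≡ suc k ℕ.* ((4 ℕ.* k ℕ.+ 2) ℕ.* c)
  arithmetic = ℕS.solve-∀

⋆-square-of-recurrence : ∀ β → β 0 ≡ + 1 → (∀ k → + suc k * β (suc k) ≡ (+ 4 * + k + + 2) * β k) →
                         β ⋆ β ≗ pow (+ 4)
⋆-square-of-recurrence β β₀ rec = square
  where
  open ≡-Reasoning
  weighted : Seq
  weighted m = ∑[ j ≤ m ] + j * (β j * β (m ∸ j))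

  weighted-sym : ∀ m → weighted m + weighted m ≡ + m * (β ⋆ β) m
  weighted-sym m = begin
    weighted m + weighted m
      ≡⟨ cong (_+ weighted m) (∑-reverse m _) ⟩
    ∑[ j ≤ m ] + (m ∸ j) * (β (m ∸ j) * β (m ∸ (m ∸ j))) + weighted m
      ≡⟨ ∑-distrib-+ m _ _ ⟨
    ∑[ j ≤ m ] (+ (m ∸ j) * (β (m ∸ j) * β (m ∸ (m ∸ j))) + + j * (β j * β (m ∸ j)))
      ≡⟨ ∑-cong m pair ⟩
    ∑[ j ≤ m ] + m * (β j * β (m ∸ j))
      ≡⟨ *-distribˡ-∑ m (+ m) _ ⟩
    + m * (β ⋆ β) m
      ∎
    where
    combine : ∀ a b x y → a * (y * x) + b * (x * y) ≡ (b + a) * (x * y)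
    combine = solve-∀
    pair : ∀ j → j ≤ m → + (m ∸ j) * (β (m ∸ j) * β (m ∸ (m ∸ j))) + + j * (β j * β (m ∸ j))
                       ≡ + m * (β j * β (m ∸ j))
    pair j j≤m rewrite ℕP.m∸[m∸n]≡n j≤m =
      trans (combine (+ (m ∸ j)) (+ j) (β j) (β (m ∸ j)))
            (cong (_* (β j * β (m ∸ j))) (trans (sym (ℤP.pos-+ j (m ∸ j))) (cong +_ (ℕP.m+[n∸m]≡n j≤m))))

  weighted-suc : ∀ m → weighted (suc m) ≡ + 4 * weighted m + + 2 * (β ⋆ β) m
  weighted-suc m = begin
    + 0 * (β 0 * β (suc m)) + ∑[ j ≤ m ] + suc j * (β (suc j) * β (m ∸ j))
      ≡⟨ cong₂ _+_ (ℤP.*-zeroˡ (β 0 * β (suc m))) (∑-cong m (λ j _ → step j)) ⟩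
    + 0 + ∑[ j ≤ m ] (+ 4 * (+ j * (β j * β (m ∸ j))) + + 2 * (β j * β (m ∸ j)))
      ≡⟨ ℤP.+-identityˡ _ ⟩
    ∑[ j ≤ m ] (+ 4 * (+ j * (β j * β (m ∸ j))) + + 2 * (β j * β (m ∸ j)))
      ≡⟨ ∑-distrib-+ m _ _ ⟩
    ∑[ j ≤ m ] + 4 * (+ j * (β j * β (m ∸ j))) + ∑[ j ≤ m ] + 2 * (β j * β (m ∸ j))
      ≡⟨ cong₂ _+_ (*-distribˡ-∑ m (+ 4) _) (*-distribˡ-∑ m (+ 2) _) ⟩
    + 4 * weighted m + + 2 * (β ⋆ β) m
      ∎
    where
    expand : ∀ k x y → (+ 4 * k + + 2) * x * y ≡ + 4 * (k * (x * y)) + + 2 * (x * y)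
    expand = solve-∀
    step : ∀ j → + suc j * (β (suc j) * β (m ∸ j)) ≡ + 4 * (+ j * (β j * β (m ∸ j))) + + 2 * (β j * β (m ∸ j))
    step j = trans (sym (ℤP.*-assoc (+ suc j) (β (suc j)) (β (m ∸ j))))
                   (trans (cong (_* β (m ∸ j)) (rec j)) (expand (+ j) (β j) (β (m ∸ j))))

  square-suc : ∀ m → (β ⋆ β) (suc m) ≡ + 4 * (β ⋆ β) m
  square-suc m = ℤP.*-cancelˡ-≡ (+ suc m) _ _ (begin
    + suc m * (β ⋆ β) (suc m)                                   ≡⟨ weighted-sym (suc m) ⟨
    weighted (suc m) + weighted (suc m)                         ≡⟨ cong₂ _+_ (weighted-suc m) (weighted-suc m) ⟩
    (+ 4 * D + + 2 * S) + (+ 4 * D + + 2 * S)                   ≡⟨ regroup D S ⟩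
    + 4 * (D + D) + + 4 * S                                     ≡⟨ cong (λ x → + 4 * x + + 4 * S) (weighted-sym m) ⟩
    + 4 * (+ m * S) + + 4 * S                                   ≡⟨ factor (+ m) S ⟩
    (+ 1 + + m) * (+ 4 * S)                                     ∎)
    where
    D = weighted m
    S = (β ⋆ β) m
    regroup : ∀ d s → (+ 4 * d + + 2 * s) + (+ 4 * d + + 2 * s) ≡ + 4 * (d + d) + + 4 * s
    regroup = solve-∀
    factor : ∀ m s → + 4 * (m * s) + + 4 * s ≡ (+ 1 + m) * (+ 4 * s)
    factor = solve-∀

  square : β ⋆ β ≗ pow (+ 4)
  square zero    = cong₂ _*_ β₀ β₀
  square (suc m) = trans (square-suc m) (cong (+ 4 *_) (square m))

central : Seq
central m = + B m

central-⋆-central : central ⋆ central ≗ pow (+ 4)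
central-⋆-central = ⋆-square-of-recurrence central refl recurrence
  where
  recurrence : ∀ k → + suc k * central (suc k) ≡ (+ 4 * + k + + 2) * central k
  recurrence k = begin
    + suc k * + B (suc k)             ≡⟨ ℤP.pos-* (suc k) (B (suc k)) ⟨
    + (suc k ℕ.* B (suc k))           ≡⟨ cong +_ (central-recurrence k) ⟩
    + ((4 ℕ.* k ℕ.+ 2) ℕ.* B k)       ≡⟨ ℤP.pos-* (4 ℕ.* k ℕ.+ 2) (B k) ⟩
    + (4 ℕ.* k ℕ.+ 2) * + B k         ≡⟨ cong (_* + B k) (trans (ℤP.pos-+ (4 ℕ.* k) 2) (cong (_+ + 2) (ℤP.pos-* 4 k))) ⟩
    (+ 4 * + k + + 2) * + B k         ∎
    where open ≡-Reasoning

-- Weighted walks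

-- walkSum c w l d t sums over the 2^l step sequences of length l of a walk started at distance d
-- from the axis at time t; a visit to the axis at time s weighs c s and the final distance e weighs
-- w e.  Only distances are tracked: from the axis both steps lead to distance 1.
walkSum : Seq → Seq → ℕ → ℕ → ℕ → ℤ
walkSum c w zero    zero    t = c t * w 0
walkSum c w zero    (suc d) t = w (suc d)
walkSum c w (suc l) zero    t = c t * (+ 2 * walkSum c w l 1 (suc t))
walkSum c w (suc l) (suc d) t = walkSum c w l d (suc t) + walkSum c w l (suc (suc d)) (suc t)

-- avoidSum w l d is the part of walkSum c w l d t from walks never on the axis (not even at the
-- start); firstPassages j d counts the walks from distance d that first reach the axis at time j.
avoidSum : Seq → ℕ → ℕ → ℤ
avoidSum w l       zero    = + 0
avoidSum w zero    (suc d) = w (suc d)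
avoidSum w (suc l) (suc d) = avoidSum w l d + avoidSum w l (suc (suc d))

firstPassages : ℕ → ℕ → ℤ
firstPassages zero    zero    = + 1
firstPassages zero    (suc d) = + 0
firstPassages (suc j) zero    = + 0
firstPassages (suc j) (suc d) = firstPassages j d + firstPassages j (suc (suc d))

walkSum-firstPassage : ∀ c w l d t →
  walkSum c w l d t ≡ avoidSum w l d + ∑[ j ≤ l ] firstPassages j d * walkSum c w (l ∸ j) 0 (t ℕ.+ j)
walkSum-firstPassage c w zero zero t = begin
  c t * w 0                               ≡⟨ ℤP.*-identityˡ _ ⟨
  + 1 * (c t * w 0)                       ≡⟨ cong (λ s → + 1 * walkSum c w 0 0 s) (ℕP.+-identityʳ t) ⟨
  + 1 * walkSum c w 0 0 (t ℕ.+ 0)         ≡⟨ ℤP.+-identityˡ _ ⟨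
  + 0 + + 1 * walkSum c w 0 0 (t ℕ.+ 0)   ∎
  where open ≡-Reasoning
walkSum-firstPassage c w zero (suc d) t = sym (ℤP.+-identityʳ _)
walkSum-firstPassage c w (suc l) zero t = sym (begin
  + 0 + (+ 1 * walkSum c w (suc l) 0 (t ℕ.+ 0) + ∑[ j ≤ l ] + 0 * walkSum c w (l ∸ j) 0 (t ℕ.+ suc j))
    ≡⟨ ℤP.+-identityˡ _ ⟩
  + 1 * walkSum c w (suc l) 0 (t ℕ.+ 0) + ∑[ j ≤ l ] + 0 * walkSum c w (l ∸ j) 0 (t ℕ.+ suc j)
    ≡⟨ cong₂ _+_ (trans (ℤP.*-identityˡ _) (cong (walkSum c w (suc l) 0) (ℕP.+-identityʳ t)))
                 (∑-zero l (λ j _ → ℤP.*-zeroˡ (walkSum c w (l ∸ j) 0 (t ℕ.+ suc j)))) ⟩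
  walkSum c w (suc l) 0 t + + 0
    ≡⟨ ℤP.+-identityʳ _ ⟩
  walkSum c w (suc l) 0 t
    ∎)
  where open ≡-Reasoning
walkSum-firstPassage c w (suc l) (suc d) t = begin
  walkSum c w l d (suc t) + walkSum c w l (suc (suc d)) (suc t)
    ≡⟨ cong₂ _+_ (walkSum-firstPassage c w l d (suc t)) (walkSum-firstPassage c w l (suc (suc d)) (suc t)) ⟩
  (avoidSum w l d + ∑≤ l (passages d)) + (avoidSum w l (suc (suc d)) + ∑≤ l (passages (suc (suc d))))
    ≡⟨ interchange (avoidSum w l d) (avoidSum w l (suc (suc d))) _ _ ⟩
  avoidSum w (suc l) (suc d) + (∑≤ l (passages d) + ∑≤ l (passages (suc (suc d))))
    ≡⟨ cong (λ x → avoidSum w (suc l) (suc d) + x) (trans (sym (∑-distrib-+ l _ _)) (∑-cong l (λ j _ → merge j))) ⟩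
  avoidSum w (suc l) (suc d) + ∑[ j ≤ l ] firstPassages (suc j) (suc d) * walkSum c w (l ∸ j) 0 (t ℕ.+ suc j)
    ≡⟨ cong (λ x → avoidSum w (suc l) (suc d) + x) (ℤP.+-identityˡ _) ⟨
  avoidSum w (suc l) (suc d) + (+ 0 + ∑[ j ≤ l ] firstPassages (suc j) (suc d) * walkSum c w (l ∸ j) 0 (t ℕ.+ suc j))
    ∎
  where
  open ≡-Reasoning
  passages : ℕ → Seq
  passages e j = firstPassages j e * walkSum c w (l ∸ j) 0 (suc t ℕ.+ j)
  interchange : ∀ a b x y → (a + x) + (b + y) ≡ (a + b) + (x + y)
  interchange = solve-∀
  merge : ∀ j → passages d j + passages (suc (suc d)) j
              ≡ firstPassages (suc j) (suc d) * walkSum c w (l ∸ j) 0 (t ℕ.+ suc j)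
  merge j = trans (sym (ℤP.*-distribʳ-+ _ (firstPassages j d) (firstPassages j (suc (suc d)))))
                  (cong (λ s → firstPassages (suc j) (suc d) * walkSum c w (l ∸ j) 0 s) (sym (ℕP.+-suc t j)))

excursions : Seq
excursions zero    = + 0
excursions (suc j) = + 2 * firstPassages j 1

walkSum-fromAxis : ∀ c w l t →
  walkSum c w (suc l) 0 t
    ≡ c t * (+ 2 * avoidSum w l 1 + ∑[ j ≤ suc l ] excursions j * walkSum c w (suc l ∸ j) 0 (t ℕ.+ j))
walkSum-fromAxis c w l t = cong (c t *_) (begin
  + 2 * walkSum c w l 1 (suc t)
    ≡⟨ cong (+ 2 *_) (walkSum-firstPassage c w l 1 (suc t)) ⟩
  + 2 * (avoidSum w l 1 + ∑≤ l returns)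
    ≡⟨ ℤP.*-distribˡ-+ (+ 2) (avoidSum w l 1) _ ⟩
  + 2 * avoidSum w l 1 + + 2 * ∑≤ l returns
    ≡⟨ cong (λ x → + 2 * avoidSum w l 1 + x) (trans (sym (*-distribˡ-∑ l (+ 2) returns)) (∑-cong l (λ j _ → excursion j))) ⟩
  + 2 * avoidSum w l 1 + ∑[ j ≤ l ] excursions (suc j) * walkSum c w (l ∸ j) 0 (t ℕ.+ suc j)
    ≡⟨ cong (λ x → + 2 * avoidSum w l 1 + x) (ℤP.+-identityˡ _) ⟨
  + 2 * avoidSum w l 1 + (+ 0 + ∑[ j ≤ l ] excursions (suc j) * walkSum c w (l ∸ j) 0 (t ℕ.+ suc j))
    ∎)
  where
  open ≡-Reasoning
  returns : Seq
  returns j = firstPassages j 1 * walkSum c w (l ∸ j) 0 (suc t ℕ.+ j)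
  excursion : ∀ j → + 2 * returns j ≡ excursions (suc j) * walkSum c w (l ∸ j) 0 (t ℕ.+ suc j)
  excursion j = trans (sym (ℤP.*-assoc (+ 2) (firstPassages j 1) _))
                      (cong (λ s → excursions (suc j) * walkSum c w (l ∸ j) 0 s) (sym (ℕP.+-suc t j)))

firstPassages-odd : ∀ k j d → j ℕ.+ d ≡ suc (k ℕ.* 2) → firstPassages j d ≡ + 0
firstPassages-odd k       zero    zero    ()
firstPassages-odd k       zero    (suc d) _ = refl
firstPassages-odd k       (suc j) zero    _ = refl
firstPassages-odd zero    (suc j) (suc d) eq with trans (sym (ℕP.+-suc j d)) (ℕP.suc-injective eq)
... | ()
firstPassages-odd (suc k) (suc j) (suc d) eq =
  cong₂ _+_ (firstPassages-odd k j d j+d≡) (firstPassages-odd (suc k) j (suc (suc d)) j+d+2≡)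
  where
  j+d≡ : j ℕ.+ d ≡ suc (k ℕ.* 2)
  j+d≡ = ℕP.suc-injective (trans (sym (ℕP.+-suc j d)) (ℕP.suc-injective eq))
  j+d+2≡ : j ℕ.+ suc (suc d) ≡ suc (suc k ℕ.* 2)
  j+d+2≡ = trans (ℕP.+-suc j (suc d)) (cong suc (trans (ℕP.+-suc j d) (cong suc j+d≡)))

excursions-odd : ∀ i → excursions (suc (i ℕ.* 2)) ≡ + 0
excursions-odd i = cong (+ 2 *_) (firstPassages-odd i (i ℕ.* 2) 1 (ℕP.+-comm (i ℕ.* 2) 1))

∑-excursions : ∀ k (g : Seq) → ∑[ j ≤ k ℕ.* 2 ] excursions j * g j ≡ ∑[ i ≤ k ] excursions (i ℕ.* 2) * g (i ℕ.* 2)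
∑-excursions k g = ∑-multiples 1 k _ odd-terms
  where
  odd-terms : ∀ i r → r < 1 → excursions (suc (i ℕ.* 2 ℕ.+ r)) * g (suc (i ℕ.* 2 ℕ.+ r)) ≡ + 0
  odd-terms i zero    _ rewrite ℕP.+-identityʳ (i ℕ.* 2) | excursions-odd i = ℤP.*-zeroˡ (g (suc (i ℕ.* 2)))
  odd-terms i (suc r) (s≤s ())

walkSum-shift : ∀ p c w → (∀ t → c (p ℕ.+ t) ≡ c t) → ∀ l d t → walkSum c w l d (p ℕ.+ t) ≡ walkSum c w l d t
walkSum-shift p c w per zero    zero    t = cong (_* w 0) (per t)
walkSum-shift p c w per zero    (suc d) t = refl
walkSum-shift p c w per (suc l) zero    t =
  cong₂ (λ x y → x * (+ 2 * y)) (per t)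
        (trans (cong (walkSum c w l 1) (sym (ℕP.+-suc p t))) (walkSum-shift p c w per l 1 (suc t)))
walkSum-shift p c w per (suc l) (suc d) t = cong₂ _+_
  (trans (cong (walkSum c w l d) (sym (ℕP.+-suc p t))) (walkSum-shift p c w per l d (suc t)))
  (trans (cong (walkSum c w l (suc (suc d))) (sym (ℕP.+-suc p t))) (walkSum-shift p c w per l (suc (suc d)) (suc t)))

walkSum-unvisitable : ∀ c w l t → c t ≡ + 0 → walkSum c w l 0 t ≡ + 0
walkSum-unvisitable c w zero    t ct≡0 = trans (cong (_* w 0) ct≡0) (ℤP.*-zeroˡ (w 0))
walkSum-unvisitable c w (suc l) t ct≡0 =
  trans (cong (_* (+ 2 * walkSum c w l 1 (suc t))) ct≡0) (ℤP.*-zeroˡ (+ 2 * walkSum c w l 1 (suc t)))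

-- First returns of all paths, of bridges and of even-zeroed paths

one : Seq
one _ = + 1

nonReturning : Seq
nonReturning zero    = + 1
nonReturning (suc l) = + 2 * avoidSum one l 1

walkSum-all : ∀ l d t → walkSum one one l d t ≡ pow (+ 2) l
walkSum-all zero    zero    t = refl
walkSum-all zero    (suc d) t = refl
walkSum-all (suc l) zero    t = trans (ℤP.*-identityˡ _) (cong (+ 2 *_) (walkSum-all l 1 (suc t)))
walkSum-all (suc l) (suc d) t =
  trans (cong₂ _+_ (walkSum-all l d (suc t)) (walkSum-all l (suc (suc d)) (suc t))) (double (pow (+ 2) l))
  where
  double : ∀ x → x + x ≡ + 2 * x
  double = solve-∀

pow2-evens : ∀ m → pow (+ 2) (m ℕ.* 2) ≡ pow (+ 4) m
pow2-evens m = trans (cong (pow (+ 2)) (ℕP.*-comm m 2)) (sym (ℤP.^-*-assoc (+ 2) 2 m))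

pow4-firstReturn : pow (+ 4) ≗ evens nonReturning ⊕ evens excursions ⋆ pow (+ 4)
pow4-firstReturn zero    = refl
pow4-firstReturn (suc m) = begin
  pow (+ 4) (suc m)
    ≡⟨ trans (walkSum-all (suc m ℕ.* 2) 0 0) (pow2-evens (suc m)) ⟨
  walkSum one one (suc m ℕ.* 2) 0 0
    ≡⟨ trans (walkSum-fromAxis one one (suc (m ℕ.* 2)) 0) (ℤP.*-identityˡ _) ⟩
  nonReturning (suc m ℕ.* 2) + ∑[ j ≤ suc m ℕ.* 2 ] excursions j * walkSum one one (suc m ℕ.* 2 ∸ j) 0 j
    ≡⟨ cong (λ x → nonReturning (suc m ℕ.* 2) + x) (begin
         ∑[ j ≤ suc m ℕ.* 2 ] excursions j * walkSum one one (suc m ℕ.* 2 ∸ j) 0 j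
           ≡⟨ ∑-cong (suc m ℕ.* 2) (λ j _ → cong (excursions j *_) (walkSum-all (suc m ℕ.* 2 ∸ j) 0 j)) ⟩
         ∑[ j ≤ suc m ℕ.* 2 ] excursions j * pow (+ 2) (suc m ℕ.* 2 ∸ j)
           ≡⟨ ∑-excursions (suc m) (λ j → pow (+ 2) (suc m ℕ.* 2 ∸ j)) ⟩
         ∑[ i ≤ suc m ] excursions (i ℕ.* 2) * pow (+ 2) (suc m ℕ.* 2 ∸ i ℕ.* 2)
           ≡⟨ ∑-cong (suc m) (λ i _ → cong (excursions (i ℕ.* 2) *_)
                (trans (cong (pow (+ 2)) (sym (ℕP.*-distribʳ-∸ 2 (suc m) i))) (pow2-evens (suc m ∸ i)))) ⟩
         (evens excursions ⋆ pow (+ 4)) (suc m)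
           ∎) ⟩
  nonReturning (suc m ℕ.* 2) + (evens excursions ⋆ pow (+ 4)) (suc m)
    ∎
  where open ≡-Reasoning

walkSum-unreachable : ∀ l d t → l < d → walkSum one δ l d t ≡ + 0
walkSum-unreachable zero    (suc d)             t _         = refl
walkSum-unreachable (suc l) (suc zero)          t (s≤s ())
walkSum-unreachable (suc l) (suc (suc d))       t (s≤s l<d) =
  cong₂ _+_ (walkSum-unreachable l (suc d) (suc t) l<d)
            (walkSum-unreachable l (suc (suc (suc d))) (suc t) (ℕP.m<n⇒m<1+n (ℕP.m<n⇒m<1+n l<d)))

[2+2u]C[1+u]≡2*[1+2u]Cu : ∀ u → suc (u ℕ.+ suc u) C suc u ≡ 2 ℕ.* (suc (u ℕ.+ u) C u)
[2+2u]C[1+u]≡2*[1+2u]Cu u = begin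
  suc (u ℕ.+ suc u) C suc u    ≡⟨ cong (λ x → suc x C suc u) (ℕP.+-suc u u) ⟩
  suc n C suc u                ≡⟨ nCk+nC[k+1]≡[n+1]C[k+1] n u ⟨
  n C u ℕ.+ n C suc u          ≡⟨ cong (n C u ℕ.+_) (trans (nCk≡nC[n∸k] (s≤s (ℕP.m≤m+n u u))) (cong (n C_) (ℕP.m+n∸m≡n u u))) ⟩
  n C u ℕ.+ n C u              ≡⟨ cong (n C u ℕ.+_) (ℕP.+-identityʳ (n C u)) ⟨
  2 ℕ.* (n C u)                ∎
  where
  open ≡-Reasoning
  n = suc (u ℕ.+ u)

walkSum-toAxis : ∀ u d t → walkSum one δ (d ℕ.+ (u ℕ.+ u)) d t ≡ + ((d ℕ.+ (u ℕ.+ u)) C u)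
walkSum-toAxis zero    zero    t = refl
walkSum-toAxis zero    (suc d) t =
  cong₂ _+_ (walkSum-toAxis zero d (suc t)) (walkSum-unreachable (d ℕ.+ 0) (suc (suc d)) (suc t) d+0<2+d)
  where
  d+0<2+d : d ℕ.+ 0 < suc (suc d)
  d+0<2+d = s≤s (ℕP.≤-trans (ℕP.≤-reflexive (ℕP.+-identityʳ d)) (ℕP.n≤1+n d))
walkSum-toAxis (suc u) zero    t = begin
  + 1 * (+ 2 * walkSum one δ (u ℕ.+ suc u) 1 (suc t))   ≡⟨ ℤP.*-identityˡ _ ⟩
  + 2 * walkSum one δ (u ℕ.+ suc u) 1 (suc t)           ≡⟨ cong (λ l → + 2 * walkSum one δ l 1 (suc t)) (ℕP.+-suc u u) ⟩
  + 2 * walkSum one δ (1 ℕ.+ (u ℕ.+ u)) 1 (suc t)       ≡⟨ cong (+ 2 *_) (walkSum-toAxis u 1 (suc t)) ⟩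
  + 2 * + (suc (u ℕ.+ u) C u)                           ≡⟨ ℤP.pos-* 2 (suc (u ℕ.+ u) C u) ⟨
  + (2 ℕ.* (suc (u ℕ.+ u) C u))                         ≡⟨ cong +_ ([2+2u]C[1+u]≡2*[1+2u]Cu u) ⟨
  + (suc (u ℕ.+ suc u) C suc u)                         ∎
  where open ≡-Reasoning
walkSum-toAxis (suc u) (suc d) t = begin
  walkSum one δ L d (suc t) + walkSum one δ L (suc (suc d)) (suc t)
    ≡⟨ cong₂ _+_ (walkSum-toAxis (suc u) d (suc t))
                 (trans (cong (λ l → walkSum one δ l (suc (suc d)) (suc t)) L≡) (walkSum-toAxis u (suc (suc d)) (suc t))) ⟩
  + (L C suc u) + + ((suc (suc d) ℕ.+ (u ℕ.+ u)) C u)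
    ≡⟨ cong (λ l → + (L C suc u) + + (l C u)) L≡ ⟨
  + (L C suc u) + + (L C u)
    ≡⟨ ℤP.pos-+ (L C suc u) (L C u) ⟨
  + (L C suc u ℕ.+ L C u)
    ≡⟨ cong +_ (trans (ℕP.+-comm (L C suc u) (L C u)) (nCk+nC[k+1]≡[n+1]C[k+1] L u)) ⟩
  + (suc L C suc u)
    ∎
  where
  open ≡-Reasoning
  L = d ℕ.+ (suc u ℕ.+ suc u)
  L≡ : L ≡ suc (suc d) ℕ.+ (u ℕ.+ u)
  L≡ = trans (ℕP.+-suc d (u ℕ.+ suc u)) (cong suc (trans (cong (d ℕ.+_) (ℕP.+-suc u u)) (ℕP.+-suc d (u ℕ.+ u))))

bridges : Seq
bridges m = walkSum one δ (m ℕ.* 2) 0 0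

bridges-central : bridges ≗ central
bridges-central m = trans (cong (λ l → walkSum one δ l 0 0) (trans (ℕP.*-comm m 2) 2m≡m+m))
                          (trans (walkSum-toAxis m 0 0) (cong (λ l → + (l C m)) (sym 2m≡m+m)))
  where
  2m≡m+m : 2 ℕ.* m ≡ m ℕ.+ m
  2m≡m+m = cong (m ℕ.+_) (ℕP.+-identityʳ m)

avoidSum-δ : ∀ l d → avoidSum δ l d ≡ + 0
avoidSum-δ l       zero    = refl
avoidSum-δ zero    (suc d) = refl
avoidSum-δ (suc l) (suc d) = cong₂ _+_ (avoidSum-δ l d) (avoidSum-δ l (suc (suc d)))

bridges-firstReturn : bridges ≗ δ ⊕ evens excursions ⋆ bridges
bridges-firstReturn zero    = refl
bridges-firstReturn (suc m) = begin
  walkSum one δ (suc m ℕ.* 2) 0 0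
    ≡⟨ trans (walkSum-fromAxis one δ (suc (m ℕ.* 2)) 0) (ℤP.*-identityˡ _) ⟩
  + 2 * avoidSum δ (suc (m ℕ.* 2)) 1 + ∑[ j ≤ suc m ℕ.* 2 ] excursions j * walkSum one δ (suc m ℕ.* 2 ∸ j) 0 j
    ≡⟨ cong₂ _+_ (cong (+ 2 *_) (avoidSum-δ (suc (m ℕ.* 2)) 1)) (begin
         ∑[ j ≤ suc m ℕ.* 2 ] excursions j * walkSum one δ (suc m ℕ.* 2 ∸ j) 0 j
           ≡⟨ ∑-cong (suc m ℕ.* 2) (λ j _ → cong (excursions j *_) (time-invariant (suc m ℕ.* 2 ∸ j) j)) ⟩
         ∑[ j ≤ suc m ℕ.* 2 ] excursions j * walkSum one δ (suc m ℕ.* 2 ∸ j) 0 0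
           ≡⟨ ∑-excursions (suc m) (λ j → walkSum one δ (suc m ℕ.* 2 ∸ j) 0 0) ⟩
         ∑[ i ≤ suc m ] excursions (i ℕ.* 2) * walkSum one δ (suc m ℕ.* 2 ∸ i ℕ.* 2) 0 0
           ≡⟨ ∑-cong (suc m) (λ i _ → cong (λ l → excursions (i ℕ.* 2) * walkSum one δ l 0 0)
                                            (sym (ℕP.*-distribʳ-∸ 2 (suc m) i))) ⟩
         (evens excursions ⋆ bridges) (suc m)
           ∎) ⟩
  + 0 + (evens excursions ⋆ bridges) (suc m)
    ∎
  where
  open ≡-Reasoning
  time-invariant : ∀ l t → walkSum one δ l 0 t ≡ walkSum one δ l 0 0
  time-invariant l t = trans (cong (walkSum one δ l 0) (sym (ℕP.+-identityʳ t))) (walkSum-shift t one δ (λ _ → refl) l 0 0)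

-- Defined by recursion so that shifting time by 4 leaves it unchanged definitionally.
[4∣_] : Seq
[4∣ zero                      ] = + 1
[4∣ suc zero                  ] = + 0
[4∣ suc (suc zero)            ] = + 0
[4∣ suc (suc (suc zero))      ] = + 0
[4∣ suc (suc (suc (suc t)))   ] = [4∣ t ]

[4∣]-between : ∀ i r → r < 3 → [4∣ suc (i ℕ.* 4 ℕ.+ r) ] ≡ + 0
[4∣]-between zero    zero                (s≤s z≤n)       = refl
[4∣]-between zero    (suc zero)          (s≤s (s≤s z≤n)) = refl
[4∣]-between zero    (suc (suc zero))    _               = refl
[4∣]-between zero    (suc (suc (suc r))) (s≤s (s≤s (s≤s ())))
[4∣]-between (suc i) r                   r<3             = [4∣]-between i r r<3

walkSum-[4∣]-multiple : ∀ w l d i → walkSum [4∣_] w l d (i ℕ.* 4) ≡ walkSum [4∣_] w l d 0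
walkSum-[4∣]-multiple w l d zero    = refl
walkSum-[4∣]-multiple w l d (suc i) =
  trans (walkSum-shift 4 [4∣_] w (λ _ → refl) l d (i ℕ.* 4)) (walkSum-[4∣]-multiple w l d i)

evenZeroedCount : Seq
evenZeroedCount k = walkSum [4∣_] one (k ℕ.* 4) 0 0

evenZeroedCount-firstReturn :
  evenZeroedCount ≗ evens (evens nonReturning) ⊕ evens (evens excursions) ⋆ evenZeroedCount
evenZeroedCount-firstReturn zero    = refl
evenZeroedCount-firstReturn (suc k) = begin
  walkSum [4∣_] one (suc k ℕ.* 4) 0 0
    ≡⟨ trans (walkSum-fromAxis [4∣_] one (suc (suc (suc (k ℕ.* 4)))) 0) (ℤP.*-identityˡ _) ⟩
  nonReturning (suc k ℕ.* 4) + ∑[ j ≤ suc k ℕ.* 4 ] excursions j * walkSum [4∣_] one (suc k ℕ.* 4 ∸ j) 0 j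
    ≡⟨ cong₂ _+_ (cong nonReturning (×4≡×2×2 (suc k)))
                 (∑-multiples 3 (suc k) (λ j → excursions j * walkSum [4∣_] one (suc k ℕ.* 4 ∸ j) 0 j) unvisited) ⟩
  evens (evens nonReturning) (suc k)
    + ∑[ i ≤ suc k ] excursions (i ℕ.* 4) * walkSum [4∣_] one (suc k ℕ.* 4 ∸ i ℕ.* 4) 0 (i ℕ.* 4)
    ≡⟨ cong (λ x → evens (evens nonReturning) (suc k) + x) (∑-cong (suc k) (λ i _ →
         cong₂ _*_ (cong excursions (×4≡×2×2 i))
                   (trans (walkSum-[4∣]-multiple one (suc k ℕ.* 4 ∸ i ℕ.* 4) 0 i)
                          (cong (λ l → walkSum [4∣_] one l 0 0) (sym (ℕP.*-distribʳ-∸ 4 (suc k) i)))))) ⟩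
  evens (evens nonReturning) (suc k) + (evens (evens excursions) ⋆ evenZeroedCount) (suc k)
    ∎
  where
  open ≡-Reasoning
  ×4≡×2×2 : ∀ i → i ℕ.* 4 ≡ i ℕ.* 2 ℕ.* 2
  ×4≡×2×2 i = sym (ℕP.*-assoc i 2 2)
  unvisited : ∀ i r → r < 3 → excursions (suc (i ℕ.* 4 ℕ.+ r))
                                * walkSum [4∣_] one (suc k ℕ.* 4 ∸ suc (i ℕ.* 4 ℕ.+ r)) 0 (suc (i ℕ.* 4 ℕ.+ r)) ≡ + 0
  unvisited i r r<3 = trans (cong (excursions (suc (i ℕ.* 4 ℕ.+ r)) *_)
                                  (walkSum-unvisitable [4∣_] one (suc k ℕ.* 4 ∸ suc (i ℕ.* 4 ℕ.+ r)) (suc (i ℕ.* 4 ℕ.+ r))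
                                                       ([4∣]-between i r r<3)))
                            (ℤP.*-zeroʳ (excursions (suc (i ℕ.* 4 ℕ.+ r))))

-- Counting even-zeroed paths

[4∣]-divisible : ∀ {t} → 4 ∣ t → [4∣ t ] ≡ + 1
[4∣]-divisible (divides-refl q) = multiple q
  where
  multiple : ∀ q → [4∣ q ℕ.* 4 ] ≡ + 1
  multiple zero    = refl
  multiple (suc q) = multiple q

[4∣]-indivisible : ∀ t → ¬ 4 ∣ t → [4∣ t ] ≡ + 0
[4∣]-indivisible zero                      4∤0 = contradiction (4 ∣0) 4∤0
[4∣]-indivisible (suc zero)                _   = refl
[4∣]-indivisible (suc (suc zero))          _   = refl
[4∣]-indivisible (suc (suc (suc zero)))    _   = refl
[4∣]-indivisible (suc (suc (suc (suc t)))) 4∤t = [4∣]-indivisible t (4∤t ∘ ∣m∣n⇒∣m+n ∣-refl)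

EvenZeroedFrom : ∀ {l} → ℤ → ℕ → Path l → Set
EvenZeroedFrom h t p = ∀ k → h + height p k ≡ + 0 → 4 ∣ t ℕ.+ toℕ k

evenZeroedFrom? : ∀ {l} h t (p : Path l) → Dec (EvenZeroedFrom h t p)
evenZeroedFrom? h t p = all? (λ k → (h + height p k ≟ℤ + 0) →-dec (4 ∣? t ℕ.+ toℕ k))

evenZeroedFrom-start : ∀ {l} t (p : Path l) → EvenZeroedFrom (+ 0) t p → 4 ∣ t
evenZeroedFrom-start t []      ez = subst (4 ∣_) (ℕP.+-identityʳ t) (ez Fin.zero refl)
evenZeroedFrom-start t (_ ∷ _) ez = subst (4 ∣_) (ℕP.+-identityʳ t) (ez Fin.zero refl)

evenZeroedFrom-∷ : ∀ {l} h t s → (h ≡ + 0 → 4 ∣ t) →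
                   (λ (p : Path l) → EvenZeroedFrom h t (s ∷ p)) ≐ EvenZeroedFrom (h + stepVal s) (suc t)
evenZeroedFrom-∷ h t s start = tail , cons
  where
  tail : ∀ {p} → EvenZeroedFrom h t (s ∷ p) → EvenZeroedFrom (h + stepVal s) (suc t) p
  tail {p} ez k eq = subst (4 ∣_) (ℕP.+-suc t (toℕ k)) (ez (Fin.suc k) (trans (sym (ℤP.+-assoc h (stepVal s) (height p k))) eq))
  cons : ∀ {p} → EvenZeroedFrom (h + stepVal s) (suc t) p → EvenZeroedFrom h t (s ∷ p)
  cons     ez Fin.zero    eq = subst (4 ∣_) (sym (ℕP.+-identityʳ t)) (start (trans (sym (ℤP.+-identityʳ h)) eq))
  cons {p} ez (Fin.suc k) eq = subst (4 ∣_) (sym (ℕP.+-suc t (toℕ k))) (ez k (trans (ℤP.+-assoc h (stepVal s) (height p k)) eq))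

length-filter-map : ∀ {A X : Set} {P : Pred X 0ℓ} (P? : Decidable P) (f : A → X) xs →
                    length (filter P? (map f xs)) ≡ length (filter (P? ∘ f) xs)
length-filter-map P? f []       = refl
length-filter-map P? f (x ∷ xs) with does (P? (f x))
... | true  = cong suc (length-filter-map P? f xs)
... | false = length-filter-map P? f xs

count : ℕ → ℤ → ℕ → ℕ
count l h t = length (filter (evenZeroedFrom? h t) (allPaths l))

count-suc : ∀ l h t → (h ≡ + 0 → 4 ∣ t) →
            count (suc l) h t ≡ count l (h + stepVal up) (suc t) ℕ.+ count l (h + stepVal down) (suc t)
count-suc l h t start = begin
  length (filter Z? (map (up ∷_) ps ++ map (down ∷_) ps))
    ≡⟨ cong length (filter-++ Z? (map (up ∷_) ps) (map (down ∷_) ps)) ⟩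
  length (filter Z? (map (up ∷_) ps) ++ filter Z? (map (down ∷_) ps))
    ≡⟨ length-++ (filter Z? (map (up ∷_) ps)) ⟩
  length (filter Z? (map (up ∷_) ps)) ℕ.+ length (filter Z? (map (down ∷_) ps))
    ≡⟨ cong₂ ℕ._+_ (after up) (after down) ⟩
  count l (h + stepVal up) (suc t) ℕ.+ count l (h + stepVal down) (suc t)
    ∎
  where
  open ≡-Reasoning
  ps = allPaths l
  Z? = evenZeroedFrom? h t
  after : ∀ s → length (filter Z? (map (s ∷_) ps)) ≡ count l (h + stepVal s) (suc t)
  after s = trans (length-filter-map Z? (s ∷_) ps)
                  (cong length (filter-≐ _ (evenZeroedFrom? (h + stepVal s) (suc t)) (evenZeroedFrom-∷ h t s start) ps))

count-blocked : ∀ l t → ¬ 4 ∣ t → count l (+ 0) t ≡ 0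
count-blocked l t 4∤t =
  cong length (filter-none (evenZeroedFrom? (+ 0) t) (All.universal (λ p → 4∤t ∘ evenZeroedFrom-start t p) (allPaths l)))

count-zero : ∀ h t → (h ≡ + 0 → 4 ∣ t) → count 0 h t ≡ 1
count-zero h t start = cong length (filter-accept (evenZeroedFrom? h t) visits)
  where
  visits : EvenZeroedFrom h t []
  visits Fin.zero eq = subst (4 ∣_) (sym (ℕP.+-identityʳ t)) (start (trans (sym (ℤP.+-identityʳ h)) eq))

count-walkSum : ∀ l h t → + count l h t ≡ walkSum [4∣_] one l ∣ h ∣ t
count-walkSum zero (+ zero) t with 4 ∣? t
... | yes 4∣t = trans (cong +_ (count-zero (+ 0) t (λ _ → 4∣t))) (sym (trans (ℤP.*-identityʳ _) ([4∣]-divisible 4∣t)))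
... | no  4∤t = trans (cong +_ (count-blocked 0 t 4∤t)) (sym (trans (ℤP.*-identityʳ _) ([4∣]-indivisible t 4∤t)))
count-walkSum zero (+ suc d)  t = cong +_ (count-zero (+ suc d) t (λ ()))
count-walkSum zero -[1+ d ]   t = cong +_ (count-zero -[1+ d ] t (λ ()))
count-walkSum (suc l) h t = by-height h
  where
  open ≡-Reasoning
  W : ℕ → ℤ
  W d = walkSum [4∣_] one l d (suc t)
  step : ∀ h → (h ≡ + 0 → 4 ∣ t) → + count (suc l) h t ≡ W (∣ h + + 1 ∣) + W (∣ h + -[1+ 0 ] ∣)
  step h start = begin
    + count (suc l) h t
      ≡⟨ cong +_ (count-suc l h t start) ⟩
    + (count l (h + + 1) (suc t) ℕ.+ count l (h + -[1+ 0 ]) (suc t))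
      ≡⟨ ℤP.pos-+ (count l (h + + 1) (suc t)) _ ⟩
    + count l (h + + 1) (suc t) + + count l (h + -[1+ 0 ]) (suc t)
      ≡⟨ cong₂ _+_ (count-walkSum l (h + + 1) (suc t)) (count-walkSum l (h + -[1+ 0 ]) (suc t)) ⟩
    W (∣ h + + 1 ∣) + W (∣ h + -[1+ 0 ] ∣)
      ∎
  double : ∀ x → x + x ≡ + 1 * (+ 2 * x)
  double = solve-∀
  by-height : ∀ h → + count (suc l) h t ≡ walkSum [4∣_] one (suc l) ∣ h ∣ t
  by-height (+ zero) with 4 ∣? t
  ... | yes 4∣t = trans (step (+ 0) (λ _ → 4∣t))
                        (trans (double (W 1)) (cong (_* (+ 2 * W 1)) (sym ([4∣]-divisible 4∣t))))
  ... | no  4∤t = trans (cong +_ (count-blocked (suc l) t 4∤t))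
                        (sym (trans (cong (_* (+ 2 * W 1)) ([4∣]-indivisible t 4∤t)) (ℤP.*-zeroˡ (+ 2 * W 1))))
  by-height (+ suc d) = trans (step (+ suc d) (λ ()))
                              (trans (cong (λ e → W e + W d) (cong suc (ℕP.+-comm d 1))) (ℤP.+-comm (W (suc (suc d))) (W d)))
  by-height -[1+ d ]  = trans (step -[1+ d ] (λ ()))
                              (cong₂ (λ e e′ → W e + W e′) (below d) (cong (suc ∘ suc) (ℕP.+-identityʳ d)))
    where
    below : ∀ d → ∣ -[1+ d ] + + 1 ∣ ≡ d
    below zero    = refl
    below (suc d) = refl

numEvenZeroed-walkSum : ∀ l → + numEvenZeroed l ≡ walkSum [4∣_] one l 0 0
numEvenZeroed-walkSum l =
  trans (cong (+_ ∘ length) (filter-≐ evenZeroed? (evenZeroedFrom? (+ 0) 0) same-paths (allPaths l)))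
        (count-walkSum l (+ 0) 0)
  where
  from-origin : ∀ {p : Path l} → EvenZeroed p → EvenZeroedFrom (+ 0) 0 p
  from-origin {p} ez k eq = ez k (trans (sym (ℤP.+-identityˡ (height p k))) eq)
  to-origin : ∀ {p : Path l} → EvenZeroedFrom (+ 0) 0 p → EvenZeroed p
  to-origin {p} ez k eq = ez k (trans (ℤP.+-identityˡ (height p k)) eq)
  same-paths : EvenZeroed ≐ EvenZeroedFrom (+ 0) 0
  same-paths = (λ {p} → from-origin {p}) , (λ {p} → to-origin {p})

-- Solving the first-return equations

central-firstReturn : (δ ⊖ evens excursions) ⋆ central ≗ δ
central-firstReturn = recursion⇒⋆ δ (evens excursions) central λ m → begin
  central m                                      ≡⟨ bridges-central m ⟨
  bridges m                                      ≡⟨ bridges-firstReturn m ⟩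
  δ m + (evens excursions ⋆ bridges) m           ≡⟨ cong (λ x → δ m + x) (⋆-congˡ (evens excursions) bridges-central m) ⟩
  δ m + (evens excursions ⋆ central) m           ∎
  where open ≡-Reasoning

nonReturning-central : evens nonReturning ≗ central
nonReturning-central = begin
  evens nonReturning                            ≈⟨ recursion⇒⋆ (evens nonReturning) (evens excursions) (pow (+ 4)) pow4-firstReturn ⟨
  (δ ⊖ evens excursions) ⋆ pow (+ 4)            ≈⟨ ⋆-congˡ (δ ⊖ evens excursions) central-⋆-central ⟨
  (δ ⊖ evens excursions) ⋆ (central ⋆ central)  ≈⟨ ⋆-assoc (δ ⊖ evens excursions) central central ⟨
  (δ ⊖ evens excursions) ⋆ central ⋆ central    ≈⟨ ⋆-congʳ central central-firstReturn ⟩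
  δ ⋆ central                                   ≈⟨ ⋆-identityˡ central ⟩
  central                                       ∎
  where open ≗-Reasoning

central-⋆-twist : central ⋆ twist central ≗ stretch (scale (+ 4) central)
central-⋆-twist = ⋆-square-unique _ _ (λ ()) (begin
  (central ⋆ twist central) ⋆ (central ⋆ twist central)   ≈⟨ ⋆-interchange central (twist central) central (twist central) ⟩
  (central ⋆ central) ⋆ (twist central ⋆ twist central)   ≈⟨ ⋆-cong central-⋆-central (scale-⋆ -1ℤ central central) ⟩
  pow (+ 4) ⋆ twist (central ⋆ central)                   ≈⟨ ⋆-congˡ (pow (+ 4)) (scale-cong -1ℤ central-⋆-central) ⟩
  pow (+ 4) ⋆ twist (pow (+ 4))                           ≈⟨ pow-⋆-twist-pow (+ 4) ⟩
  stretch (evens (pow (+ 4)))                             ≈⟨ stretch-cong scaled-square ⟨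
  stretch (T ⋆ T)                                         ≈⟨ stretch-⋆ T T ⟨
  stretch T ⋆ stretch T                                   ∎)
  where
  open ≗-Reasoning
  T = scale (+ 4) central
  scaled-square : T ⋆ T ≗ evens (pow (+ 4))
  scaled-square = begin
    T ⋆ T                         ≈⟨ scale-⋆ (+ 4) central central ⟩
    scale (+ 4) (central ⋆ central) ≈⟨ scale-cong (+ 4) central-⋆-central ⟩
    scale (+ 4) (pow (+ 4))       ≈⟨ scale-pow (+ 4) ⟩
    evens (pow (+ 4))             ∎

scaledCentral-firstReturn : (δ ⊖ evens (evens excursions)) ⋆ scale (+ 4) central ≗ evens (evens nonReturning)
scaledCentral-firstReturn = begin
  (δ ⊖ evens (evens excursions)) ⋆ T              ≈⟨ ⋆-comm (δ ⊖ evens (evens excursions)) T ⟩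
  T ⋆ (δ ⊖ evens (evens excursions))              ≈⟨ ⋆-congˡ T evens-δ ⟨
  T ⋆ evens (δ ⊖ evens excursions)                ≈⟨ evens-stretch-⋆ T R ⟨
  evens (stretch T ⋆ R)                           ≈⟨ evens-cong (⋆-congʳ R central-⋆-twist) ⟨
  evens (central ⋆ twist central ⋆ R)             ≈⟨ evens-cong (⋆-congʳ R (⋆-comm central (twist central))) ⟩
  evens (twist central ⋆ central ⋆ R)             ≈⟨ evens-cong (⋆-assoc (twist central) central R) ⟩
  evens (twist central ⋆ (central ⋆ R))           ≈⟨ evens-cong (⋆-congˡ (twist central) central-⋆-R) ⟩
  evens (twist central ⋆ δ)                       ≈⟨ evens-cong (⋆-identityʳ (twist central)) ⟩
  evens (twist central)                           ≈⟨ evens-twist central ⟩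
  evens central                                   ≈⟨ evens-cong nonReturning-central ⟨
  evens (evens nonReturning)                      ∎
  where
  open ≗-Reasoning
  T = scale (+ 4) central
  R = δ ⊖ evens excursions
  central-⋆-R : central ⋆ R ≗ δ
  central-⋆-R n = trans (⋆-comm central R n) (central-firstReturn n)
  evens-δ : evens R ≗ δ ⊖ evens (evens excursions)
  evens-δ zero    = refl
  evens-δ (suc k) = refl

evenZeroedCount-scaledCentral : evenZeroedCount ≗ scale (+ 4) central
evenZeroedCount-scaledCentral = ⋆-cancelˡ (δ ⊖ evens (evens excursions)) (λ ()) λ k →
  trans (recursion⇒⋆ (evens (evens nonReturning)) (evens (evens excursions)) evenZeroedCount evenZeroedCount-firstReturn k)
        (sym (scaledCentral-firstReturn k))

pos-^ : ∀ m n → + (m ℕ.^ n) ≡ (+ m) ^ n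
pos-^ m zero    = refl
pos-^ m (suc n) = trans (ℤP.pos-* m (m ℕ.^ n)) (cong (+ m *_) (pos-^ m n))

lemma7 : (n : ℕ) → numEvenZeroed (4 ℕ.* n) ≡ 4 ℕ.^ n ℕ.* B n
lemma7 n = ℤP.+-injective (begin
  + numEvenZeroed (4 ℕ.* n)              ≡⟨ numEvenZeroed-walkSum (4 ℕ.* n) ⟩
  walkSum [4∣_] one (4 ℕ.* n) 0 0        ≡⟨ cong (λ l → walkSum [4∣_] one l 0 0) (ℕP.*-comm 4 n) ⟩
  evenZeroedCount n                      ≡⟨ evenZeroedCount-scaledCentral n ⟩
  pow (+ 4) n * + B n                    ≡⟨ cong (_* + B n) (pos-^ 4 n) ⟨
  + (4 ℕ.^ n) * + B n                    ≡⟨ ℤP.pos-* (4 ℕ.^ n) (B n) ⟨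
  + (4 ℕ.^ n ℕ.* B n)                    ∎)
  where open ≡-Reasoning
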